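{- Let $w$ be a word with $m$ letters $\mathsf{n}$ and $n$ letters $\mathsf{e}$. Then $w$ has no critical factor if and only if $w$ is (as a word) a staircase monomial, i.e. $w=\mathsf{e}^{n-k}(\mathsf{ne})^k\mathsf{n}^{m-k}$ for some $0\leq k\leq\min(m,n)$.
   Context: A word with $m$ letters $\mathsf{n}$ and $n$ letters $\mathsf{e}$ is identified with the lattice path from $(0,0)$ to $(n,m)$ obtained by reading it left to right ($\mathsf{n}$ = unit north step, $\mathsf{e}$ = unit east step); each letter corresponds to a unit step (edge) of the path. Its partition $\lambda(w)$ is the set of cells of the $m\times n$ box lying to the upper-left of the path. For $0\leq k\leq\min(m,n)$ let $\delta_k=\mathsf{e}^{n-k}(\mathsf{ne})^k\mathsf{n}^{m-k}$. The path of $u$ lies weakly below the path of $w$ if $\lambda(w)\subseteq\lambda(u)$. Let $m_w$ be the largest $k$ such that the path of $\delta_k$ lies weakly below the path of $w$. A factor (contiguous subword) $w'$ of $w$ is of admissible form if either $w'=\mathsf{n}^i\mathsf{e}$ with $i\geq 2$ and the run $\mathsf{n}^i$ maximal (the letter immediately before $w'$ in $w$, if any, is not $\mathsf{n}$), or $w'=\mathsf{n}\mathsf{e}^i$ with $i\geq 2$ and the run $\mathsf{e}^i$ maximal (the letter immediately after $w'$ in $w$, if any, is not $\mathsf{e}$). Such a factor is critical if the path of $w$ shares an edge with the path of $\delta_{m_w}$ at one of the letters of $w'$, i.e. the unit step of the path of $w$ corresponding to some letter of $w'$ is also a unit step of the path of $\delta_{m_w}$. -}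

module Defs where

open import Data.Nat using (ℕ; zero; suc; _+_; _∸_; _⊓_; _≤_; _<_)
open import Data.Product using (_×_; _,_; Σ; ∃; ∃-syntax)
open import Data.Sum using (_⊎_)
open import Data.List using (List; []; _∷_; _++_; replicate)
open import Data.List.Membership.Propositional using (_∈_)
open import Relation.Binary.PropositionalEquality using (_≡_)
open import Relation.Nullary using (¬_)

-- Letters: 𝐧 = unit north step, 𝐞 = unit east step.
data Letter : Set where
  𝐧 𝐞 : Letter

Word : Set
Word = List Letter

count𝐧 : Word → ℕ
count𝐧 []       = 0
count𝐧 (𝐧 ∷ w) = suc (count𝐧 w)
count𝐧 (𝐞 ∷ w) = count𝐧 w

count𝐞 : Word → ℕ
count𝐞 []       = 0
count𝐞 (𝐧 ∷ w) = count𝐞 w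
count𝐞 (𝐞 ∷ w) = suc (count𝐞 w)

ne^ : ℕ → Word
ne^ zero    = []
ne^ (suc k) = 𝐧 ∷ 𝐞 ∷ ne^ k

δ : (m n k : ℕ) → Word
δ m n k = replicate (n ∸ k) 𝐞 ++ ne^ k ++ replicate (m ∸ k) 𝐧

-- Lattice points (x , y): x = number of east steps, y = number of north steps.
Point : Set
Point = ℕ × ℕ

-- A unit step of a path: its starting point and its direction.
-- (A unit axis-parallel segment traversed north/east is determined by these.)
Edge : Set
Edge = Point × Letter

step : Point → Letter → Point
step (x , y) 𝐧 = (x , suc y)
step (x , y) 𝐞 = (suc x , y)

endPoint : Point → Word → Point
endPoint p []      = p
endPoint p (l ∷ w) = endPoint (step p l) w

edgesFrom : Point → Word → List Edge
edgesFrom p []      = []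
edgesFrom p (l ∷ w) = (p , l) ∷ edgesFrom (step p l) w

origin : Point
origin = (0 , 0)

-- height of the (i+1)-th east step of the path of w (i.e. the number of
-- letters 𝐧 preceding the (i+1)-th letter 𝐞); this is the lower boundary of
-- column i (the strip i ≤ x ≤ i+1) below the path.
eastHeight : Word → ℕ → ℕ
eastHeight []       i       = 0
eastHeight (𝐧 ∷ w) i       = suc (eastHeight w i)
eastHeight (𝐞 ∷ w) zero    = 0
eastHeight (𝐞 ∷ w) (suc i) = eastHeight w i

-- Cell (i , j) = unit square [i,i+1]×[j,j+1] of the m×n box (i < n, j < m)
-- lies to the upper-left of the path of w, i.e. belongs to λ(w).
InLam : Word → ℕ → ℕ → Set
InLam w i j = eastHeight w i ≤ j

-- λ(w) ⊆ λ(u) as sets of cells of the m × n box.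
-- "The path of u lies weakly below the path of w."
WeaklyBelow : (m n : ℕ) → (u w : Word) → Set
WeaklyBelow m n u w = ∀ i j → i < n → j < m → InLam w i j → InLam u i j

IsMw : (m n : ℕ) → Word → ℕ → Set
IsMw m n w k =
  k ≤ m ⊓ n × WeaklyBelow m n (δ m n k) w ×
  (∀ k' → k' ≤ m ⊓ n → WeaklyBelow m n (δ m n k') w → k' ≤ k)

EndsWith𝐧 : Word → Set
EndsWith𝐧 p = ∃[ q ] p ≡ q ++ 𝐧 ∷ []

StartsWith𝐞 : Word → Set
StartsWith𝐞 s = ∃[ q ] s ≡ 𝐞 ∷ q

Admissible : (p f s : Word) → Set
Admissible p f s =
  (∃[ i ] (2 ≤ i × f ≡ replicate i 𝐧 ++ 𝐞 ∷ [] × ¬ EndsWith𝐧 p)) ⊎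
  (∃[ i ] (2 ≤ i × f ≡ 𝐧 ∷ replicate i 𝐞 × ¬ StartsWith𝐞 s))

HasCriticalFactor : (m n : ℕ) → Word → Set
HasCriticalFactor m n w =
  ∃[ p ] ∃[ f ] ∃[ s ] (w ≡ p ++ f ++ s × Admissible p f s ×
    ∃[ k ] (IsMw m n w k ×
      ∃[ ed ] (ed ∈ edgesFrom (endPoint origin p) f × ed ∈ edgesFrom origin (δ m n k))))

{-# OPTIONS --safe #-}
-- If w = δ_k, then δ_k contains neither 𝐧𝐧 followed later by 𝐞 nor 𝐧𝐞𝐞, hence no admissible factor.
-- Conversely let k = m_w, so that w lies weakly above d = δ_k.  Maximality of k makes w meet d in a
-- common east step (a common first step 𝐧 when k = n).  Walking forward from it, the first place where
-- w leaves d has w going north where d goes east, since d never rises above w; d is a staircase there,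
-- so w's maximal run 𝐧^i 𝐞 (i ≥ 2) begins with a step of d.  Walking backward, at the place where w
-- last rejoins d, w arrives by 𝐞 and d by 𝐧, and both continue by a common 𝐞 (d has no 𝐞 after 𝐧𝐧);
-- that common step lies in w's factor 𝐧𝐞^i with i ≥ 2.  So w has a critical factor unless w = δ_k.

module Submission where

open import Defs
open import Data.Empty using (⊥; ⊥-elim)
open import Data.List using ([]; _∷_; _++_; _∷ʳ_; replicate)
open import Data.List.Properties using (++-assoc; ++-identityʳ; ∷ʳ-injective; ∷ʳ-++)
open import Data.List.Membership.Propositional using (_∈_)
open import Data.List.Relation.Unary.Any using (here; there)
open import Data.List.Reverse using (Reverse; reverseView; []; _∶_∶ʳ_)
open import Data.Nat using (ℕ; zero; suc; _+_; _∸_; _⊓_; _≤_; _<_; z≤n; s≤s; s≤s⁻¹; z<s)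
open import Data.Nat.Properties
open import Data.Nat.Tactic.RingSolver using (solve-∀)
open import Data.Product using (_×_; _,_; ∃-syntax; proj₂)
open import Data.Sum as Sum using (_⊎_; inj₁; inj₂)
open import Data.Unit using (⊤; tt)
open import Function.Bundles using (_⇔_; mk⇔; Equivalence)
open import Function.Properties.Equivalence using () renaming (trans to ⇔-trans)
open import Relation.Binary.PropositionalEquality
open import Relation.Nullary using (¬_; Dec; yes; no; ¬?)
open import Relation.Nullary.Decidable using (decidable-stable)
open import Relation.Unary using (Decidable)

count : Letter → Word → ℕ
count 𝐧 = count𝐧
count 𝐞 = count𝐞

count-++ : ∀ l u v → count l (u ++ v) ≡ count l u + count l v
count-++ 𝐧 []      v = refl
count-++ 𝐞 []      v = refl
count-++ 𝐧 (𝐧 ∷ u) v = cong suc (count-++ 𝐧 u v)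
count-++ 𝐧 (𝐞 ∷ u) v = count-++ 𝐧 u v
count-++ 𝐞 (𝐧 ∷ u) v = count-++ 𝐞 u v
count-++ 𝐞 (𝐞 ∷ u) v = cong suc (count-++ 𝐞 u v)

count-prefix-≤ : ∀ l u v → count l u ≤ count l (u ++ v)
count-prefix-≤ l u v = subst (count l u ≤_) (sym (count-++ l u v)) (m≤m+n _ _)

count𝐧-∷ʳ-𝐧 : ∀ u → count𝐧 (u ∷ʳ 𝐧) ≡ suc (count𝐧 u)
count𝐧-∷ʳ-𝐧 []      = refl
count𝐧-∷ʳ-𝐧 (𝐧 ∷ u) = cong suc (count𝐧-∷ʳ-𝐧 u)
count𝐧-∷ʳ-𝐧 (𝐞 ∷ u) = count𝐧-∷ʳ-𝐧 u

count-replicate : ∀ l r → count l (replicate r l) ≡ r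
count-replicate 𝐧 zero    = refl
count-replicate 𝐧 (suc r) = cong suc (count-replicate 𝐧 r)
count-replicate 𝐞 zero    = refl
count-replicate 𝐞 (suc r) = cong suc (count-replicate 𝐞 r)

count𝐧-replicate-𝐞 : ∀ r → count𝐧 (replicate r 𝐞) ≡ 0
count𝐧-replicate-𝐞 zero    = refl
count𝐧-replicate-𝐞 (suc r) = count𝐧-replicate-𝐞 r

count𝐞-replicate-𝐧 : ∀ r → count𝐞 (replicate r 𝐧) ≡ 0
count𝐞-replicate-𝐧 zero    = refl
count𝐞-replicate-𝐧 (suc r) = count𝐞-replicate-𝐧 r

count-ne^ : ∀ l k → count l (ne^ k) ≡ k
count-ne^ 𝐧 zero    = refl
count-ne^ 𝐧 (suc k) = cong suc (count-ne^ 𝐧 k)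
count-ne^ 𝐞 zero    = refl
count-ne^ 𝐞 (suc k) = cong suc (count-ne^ 𝐞 k)

count𝐞≡0⇒replicate-𝐧 : ∀ w → count𝐞 w ≡ 0 → w ≡ replicate (count𝐧 w) 𝐧
count𝐞≡0⇒replicate-𝐧 []      _  = refl
count𝐞≡0⇒replicate-𝐧 (𝐧 ∷ w) eq = cong (𝐧 ∷_) (count𝐞≡0⇒replicate-𝐧 w eq)

replicate-+ : ∀ (x : Letter) i j → replicate (i + j) x ≡ replicate i x ++ replicate j x
replicate-+ x zero    j = refl
replicate-+ x (suc i) j = cong (x ∷_) (replicate-+ x i j)

SamePoint : Word → Word → Set
SamePoint u v = ∀ l → count l u ≡ count l v

samePoint-sym : ∀ {u v} → SamePoint u v → SamePoint v u
samePoint-sym eq l = sym (eq l)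

samePoint-++ʳ : ∀ {u v} x → SamePoint u v → SamePoint (u ++ x) (v ++ x)
samePoint-++ʳ {u} {v} x eq l = begin
  count l (u ++ x)      ≡⟨ count-++ l u x ⟩
  count l u + count l x ≡⟨ cong (_+ count l x) (eq l) ⟩
  count l v + count l x ≡⟨ count-++ l v x ⟨
  count l (v ++ x)      ∎
  where open ≡-Reasoning

samePoint-cancelˡ : ∀ {u v} x y → SamePoint u v → SamePoint (u ++ x) (v ++ y) → SamePoint x y
samePoint-cancelˡ {u} {v} x y eq eq′ l = +-cancelˡ-≡ (count l u) _ _ (begin
  count l u + count l x ≡⟨ count-++ l u x ⟨
  count l (u ++ x)      ≡⟨ eq′ l ⟩
  count l (v ++ y)      ≡⟨ count-++ l v y ⟩
  count l v + count l y ≡⟨ cong (_+ count l y) (eq l) ⟨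
  count l u + count l y ∎)
  where open ≡-Reasoning

samePoint-cancelʳ : ∀ {u v} x → SamePoint (u ++ x) (v ++ x) → SamePoint u v
samePoint-cancelʳ {u} {v} x eq l = +-cancelʳ-≡ (count l x) _ _
  (trans (sym (count-++ l u x)) (trans (eq l) (count-++ l v x)))

samePoint-[] : ∀ {u} → SamePoint u [] → u ≡ []
samePoint-[] {[]}    _  = refl
samePoint-[] {𝐧 ∷ u} eq with eq 𝐧
... | ()
samePoint-[] {𝐞 ∷ u} eq with eq 𝐞
... | ()

endPoint-++ : ∀ q u v → endPoint q (u ++ v) ≡ endPoint (endPoint q u) v
endPoint-++ q []      v = refl
endPoint-++ q (l ∷ u) v = endPoint-++ (step q l) u v

endPoint-counts : ∀ x y u → endPoint (x , y) u ≡ (x + count𝐞 u , y + count𝐧 u)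
endPoint-counts x y []      = sym (cong₂ _,_ (+-identityʳ x) (+-identityʳ y))
endPoint-counts x y (𝐧 ∷ u) = trans (endPoint-counts x (suc y) u) (cong (x + count𝐞 u ,_) (sym (+-suc y _)))
endPoint-counts x y (𝐞 ∷ u) = trans (endPoint-counts (suc x) y u) (cong (_, y + count𝐧 u) (sym (+-suc x _)))

samePoint⇒endPoint≡ : ∀ {u v} → SamePoint u v → endPoint origin u ≡ endPoint origin v
samePoint⇒endPoint≡ {u} {v} eq =
  trans (endPoint-counts 0 0 u) (trans (cong₂ _,_ (eq 𝐞) (eq 𝐧)) (sym (endPoint-counts 0 0 v)))

edge∈edgesFrom : ∀ q u l v → (endPoint q u , l) ∈ edgesFrom q (u ++ l ∷ v)
edge∈edgesFrom q []      l v = here refl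
edge∈edgesFrom q (x ∷ u) l v = there (edge∈edgesFrom (step q x) u l v)

SharedEdge : Word → Word → Word → Set
SharedEdge p f d = ∃[ ed ] (ed ∈ edgesFrom (endPoint origin p) f × ed ∈ edgesFrom origin d)

sharedEdge : ∀ {p f d} f₁ l f₂ d₁ d₂ → f ≡ f₁ ++ l ∷ f₂ → d ≡ d₁ ++ l ∷ d₂ →
             SamePoint (p ++ f₁) d₁ → SharedEdge p f d
sharedEdge {p} f₁ l f₂ d₁ d₂ refl refl eq =
  (endPoint origin d₁ , l) ,
  subst (λ q → (q , l) ∈ edgesFrom (endPoint origin p) (f₁ ++ l ∷ f₂))
        (trans (sym (endPoint-++ origin p f₁)) (samePoint⇒endPoint≡ eq))
        (edge∈edgesFrom _ f₁ l f₂) ,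
  edge∈edgesFrom origin d₁ l d₂

eastHeight-++-< : ∀ u v i → i < count𝐞 u → eastHeight (u ++ v) i ≤ count𝐧 u
eastHeight-++-< (𝐧 ∷ u) v i       i<   = s≤s (eastHeight-++-< u v i i<)
eastHeight-++-< (𝐞 ∷ u) v zero    _    = z≤n
eastHeight-++-< (𝐞 ∷ u) v (suc i) i<   = eastHeight-++-< u v i (s≤s⁻¹ i<)

eastHeight-at-𝐞 : ∀ u v → eastHeight (u ++ 𝐞 ∷ v) (count𝐞 u) ≡ count𝐧 u
eastHeight-at-𝐞 []      v = refl
eastHeight-at-𝐞 (𝐧 ∷ u) v = cong suc (eastHeight-at-𝐞 u v)
eastHeight-at-𝐞 (𝐞 ∷ u) v = eastHeight-at-𝐞 u v

eastHeight-at-𝐧 : ∀ u v → count𝐧 u < eastHeight (u ++ 𝐧 ∷ v) (count𝐞 u)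
eastHeight-at-𝐧 []      v = s≤s z≤n
eastHeight-at-𝐧 (𝐧 ∷ u) v = s≤s (eastHeight-at-𝐧 u v)
eastHeight-at-𝐧 (𝐞 ∷ u) v = eastHeight-at-𝐧 u v

eastHeight≤count𝐧 : ∀ w i → eastHeight w i ≤ count𝐧 w
eastHeight≤count𝐧 []      i       = z≤n
eastHeight≤count𝐧 (𝐧 ∷ w) i       = s≤s (eastHeight≤count𝐧 w i)
eastHeight≤count𝐧 (𝐞 ∷ w) zero    = z≤n
eastHeight≤count𝐧 (𝐞 ∷ w) (suc i) = eastHeight≤count𝐧 w i

eastHeight-replicate-𝐞 : ∀ a v i → i < a → eastHeight (replicate a 𝐞 ++ v) i ≡ 0
eastHeight-replicate-𝐞 (suc a) v zero    _  = refl
eastHeight-replicate-𝐞 (suc a) v (suc i) i< = eastHeight-replicate-𝐞 a v i (s≤s⁻¹ i<)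

eastHeight-replicate-𝐞-+ : ∀ a v j → eastHeight (replicate a 𝐞 ++ v) (a + j) ≡ eastHeight v j
eastHeight-replicate-𝐞-+ zero    v j = refl
eastHeight-replicate-𝐞-+ (suc a) v j = eastHeight-replicate-𝐞-+ a v j

eastHeight-ne^ : ∀ k v j → j < k → eastHeight (ne^ k ++ v) j ≡ suc j
eastHeight-ne^ (suc k) v zero    _  = refl
eastHeight-ne^ (suc k) v (suc j) j< = cong suc (eastHeight-ne^ k v j (s≤s⁻¹ j<))

splitAt-𝐞 : ∀ w i → i < count𝐞 w →
            ∃[ u ] ∃[ v ] (w ≡ u ++ 𝐞 ∷ v × count𝐞 u ≡ i × count𝐧 u ≡ eastHeight w i)
splitAt-𝐞 (𝐧 ∷ w) i i< with splitAt-𝐞 w i i<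
... | u , v , refl , e , n = 𝐧 ∷ u , v , refl , e , cong suc n
splitAt-𝐞 (𝐞 ∷ w) zero    _  = [] , w , refl , refl , refl
splitAt-𝐞 (𝐞 ∷ w) (suc i) i< with splitAt-𝐞 w i (s≤s⁻¹ i<)
... | u , v , refl , e , n = 𝐞 ∷ u , v , refl , cong suc e , n

split-leading-𝐧 : ∀ w → (∃[ j ] ∃[ v ] w ≡ replicate j 𝐧 ++ 𝐞 ∷ v) ⊎ count𝐞 w ≡ 0
split-leading-𝐧 []      = inj₂ refl
split-leading-𝐧 (𝐞 ∷ w) = inj₁ (0 , w , refl)
split-leading-𝐧 (𝐧 ∷ w) with split-leading-𝐧 w
... | inj₁ (j , v , refl) = inj₁ (suc j , v , refl)
... | inj₂ eq             = inj₂ eq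

split-leading-𝐞 : ∀ w → ∃[ r ] ∃[ v ] (w ≡ replicate r 𝐞 ++ v × ¬ StartsWith𝐞 v)
split-leading-𝐞 []      = 0 , [] , refl , λ ()
split-leading-𝐞 (𝐧 ∷ w) = 0 , 𝐧 ∷ w , refl , λ ()
split-leading-𝐞 (𝐞 ∷ w) with split-leading-𝐞 w
... | r , v , refl , ¬𝐞 = suc r , v , refl , ¬𝐞

split-trailing-𝐞 : ∀ w → (∃[ j ] w ≡ replicate j 𝐞) ⊎ (∃[ u ] ∃[ j ] w ≡ u ++ 𝐧 ∷ replicate j 𝐞)
split-trailing-𝐞 []      = inj₁ (0 , refl)
split-trailing-𝐞 (𝐞 ∷ w) with split-trailing-𝐞 w
... | inj₁ (j , refl)     = inj₁ (suc j , refl)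
... | inj₂ (u , j , refl) = inj₂ (𝐞 ∷ u , j , refl)
split-trailing-𝐞 (𝐧 ∷ w) with split-trailing-𝐞 w
... | inj₁ (j , refl)     = inj₂ ([] , j , refl)
... | inj₂ (u , j , refl) = inj₂ (𝐧 ∷ u , j , refl)

endsWith𝐧? : ∀ w → Dec (EndsWith𝐧 w)
endsWith𝐧? w with reverseView w
... | []           = no λ { ([] , ()) ; (_ ∷ _ , ()) }
... | u ∶ _ ∶ʳ 𝐧   = yes (u , refl)
... | u ∶ _ ∶ʳ 𝐞   = no λ { (v , eq) → 𝐞≢𝐧 (proj₂ (∷ʳ-injective u v eq)) }
  where
  𝐞≢𝐧 : 𝐞 ≢ 𝐧
  𝐞≢𝐧 ()

No𝐞𝐞 : Word → Set
No𝐞𝐞 []          = ⊤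
No𝐞𝐞 (𝐧 ∷ u)     = No𝐞𝐞 u
No𝐞𝐞 (𝐞 ∷ [])    = ⊤
No𝐞𝐞 (𝐞 ∷ 𝐧 ∷ u) = No𝐞𝐞 u
No𝐞𝐞 (𝐞 ∷ 𝐞 ∷ u) = ⊥

No𝐞𝐞-tail : ∀ l u → No𝐞𝐞 (l ∷ u) → No𝐞𝐞 u
No𝐞𝐞-tail 𝐧 u       h = h
No𝐞𝐞-tail 𝐞 []      _ = tt
No𝐞𝐞-tail 𝐞 (𝐧 ∷ u) h = h

No𝐞𝐞-suffix : ∀ u v → No𝐞𝐞 (u ++ v) → No𝐞𝐞 v
No𝐞𝐞-suffix []      v h = h
No𝐞𝐞-suffix (l ∷ u) v h = No𝐞𝐞-suffix u v (No𝐞𝐞-tail l (u ++ v) h)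

No𝐞𝐞After𝐧 : Word → Set
No𝐞𝐞After𝐧 []      = ⊤
No𝐞𝐞After𝐧 (𝐞 ∷ u) = No𝐞𝐞After𝐧 u
No𝐞𝐞After𝐧 (𝐧 ∷ u) = No𝐞𝐞 u

¬No𝐞𝐞After𝐧-𝐧𝐞𝐞 : ∀ u v → ¬ No𝐞𝐞After𝐧 (u ++ 𝐧 ∷ 𝐞 ∷ 𝐞 ∷ v)
¬No𝐞𝐞After𝐧-𝐧𝐞𝐞 []      v h = h
¬No𝐞𝐞After𝐧-𝐧𝐞𝐞 (𝐞 ∷ u) v h = ¬No𝐞𝐞After𝐧-𝐧𝐞𝐞 u v h
¬No𝐞𝐞After𝐧-𝐧𝐞𝐞 (𝐧 ∷ u) v h = No𝐞𝐞-suffix u (𝐧 ∷ 𝐞 ∷ 𝐞 ∷ v) h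

No𝐞After𝐧𝐧 : Word → Set
No𝐞After𝐧𝐧 []          = ⊤
No𝐞After𝐧𝐧 (𝐞 ∷ u)     = No𝐞After𝐧𝐧 u
No𝐞After𝐧𝐧 (𝐧 ∷ [])    = ⊤
No𝐞After𝐧𝐧 (𝐧 ∷ 𝐞 ∷ u) = No𝐞After𝐧𝐧 u
No𝐞After𝐧𝐧 (𝐧 ∷ 𝐧 ∷ u) = count𝐞 u ≡ 0

No𝐞After𝐧𝐧-𝐧𝐧 : ∀ u v → No𝐞After𝐧𝐧 (u ++ 𝐧 ∷ 𝐧 ∷ v) → count𝐞 v ≡ 0
No𝐞After𝐧𝐧-𝐧𝐧 []          v h = h
No𝐞After𝐧𝐧-𝐧𝐧 (𝐞 ∷ u)     v h = No𝐞After𝐧𝐧-𝐧𝐧 u v h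
No𝐞After𝐧𝐧-𝐧𝐧 (𝐧 ∷ [])    v h = h
No𝐞After𝐧𝐧-𝐧𝐧 (𝐧 ∷ 𝐞 ∷ u) v h = No𝐞After𝐧𝐧-𝐧𝐧 u v h
No𝐞After𝐧𝐧-𝐧𝐧 (𝐧 ∷ 𝐧 ∷ u) v h = m+n≡0⇒n≡0 (count𝐞 u) (trans (sym (count-++ 𝐞 u _)) h)

No𝐞𝐞-replicate-𝐧 : ∀ r → No𝐞𝐞 (replicate r 𝐧)
No𝐞𝐞-replicate-𝐧 zero    = tt
No𝐞𝐞-replicate-𝐧 (suc r) = No𝐞𝐞-replicate-𝐧 r

No𝐞𝐞-𝐞∷ne^++replicate-𝐧 : ∀ k r → No𝐞𝐞 (𝐞 ∷ ne^ k ++ replicate r 𝐧)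
No𝐞𝐞-𝐞∷ne^++replicate-𝐧 zero    zero    = tt
No𝐞𝐞-𝐞∷ne^++replicate-𝐧 zero    (suc r) = No𝐞𝐞-replicate-𝐧 r
No𝐞𝐞-𝐞∷ne^++replicate-𝐧 (suc k) r       = No𝐞𝐞-𝐞∷ne^++replicate-𝐧 k r

δ-No𝐞𝐞After𝐧 : ∀ m n k → No𝐞𝐞After𝐧 (δ m n k)
δ-No𝐞𝐞After𝐧 m n k = afterPrefix (n ∸ k)
  where
  steps : ∀ k r → No𝐞𝐞After𝐧 (ne^ k ++ replicate r 𝐧)
  steps zero    zero    = tt
  steps zero    (suc r) = No𝐞𝐞-replicate-𝐧 r
  steps (suc k) r       = No𝐞𝐞-𝐞∷ne^++replicate-𝐧 k r
  afterPrefix : ∀ a → No𝐞𝐞After𝐧 (replicate a 𝐞 ++ ne^ k ++ replicate (m ∸ k) 𝐧)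
  afterPrefix zero    = steps k (m ∸ k)
  afterPrefix (suc a) = afterPrefix a

δ-No𝐞After𝐧𝐧 : ∀ m n k → No𝐞After𝐧𝐧 (δ m n k)
δ-No𝐞After𝐧𝐧 m n k = afterPrefix (n ∸ k)
  where
  column : ∀ r → No𝐞After𝐧𝐧 (replicate r 𝐧)
  column zero          = tt
  column (suc zero)    = tt
  column (suc (suc r)) = count𝐞-replicate-𝐧 r
  steps : ∀ k r → No𝐞After𝐧𝐧 (ne^ k ++ replicate r 𝐧)
  steps zero    r = column r
  steps (suc k) r = steps k r
  afterPrefix : ∀ a → No𝐞After𝐧𝐧 (replicate a 𝐞 ++ ne^ k ++ replicate (m ∸ k) 𝐧)
  afterPrefix zero    = steps k (m ∸ k)
  afterPrefix (suc a) = afterPrefix a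

δ-¬Admissible : ∀ m n k p f s → δ m n k ≡ p ++ f ++ s → ¬ Admissible p f s
δ-¬Admissible m n k p _ s eq (inj₁ (suc (suc i) , s≤s (s≤s _) , refl , _)) =
  0≢1+n (trans (sym (No𝐞After𝐧𝐧-𝐧𝐧 p _ (subst No𝐞After𝐧𝐧 eq (δ-No𝐞After𝐧𝐧 m n k)))) (count𝐞-𝐧^i𝐞++ i))
  where
  count𝐞-𝐧^i𝐞++ : ∀ i → count𝐞 ((replicate i 𝐧 ++ 𝐞 ∷ []) ++ s) ≡ suc (count𝐞 s)
  count𝐞-𝐧^i𝐞++ zero    = refl
  count𝐞-𝐧^i𝐞++ (suc i) = count𝐞-𝐧^i𝐞++ i
δ-¬Admissible m n k p _ s eq (inj₂ (suc (suc i) , s≤s (s≤s _) , refl , _)) =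
  ¬No𝐞𝐞After𝐧-𝐧𝐞𝐞 p _ (subst No𝐞𝐞After𝐧 eq (δ-No𝐞𝐞After𝐧 m n k))

count𝐧-δ : ∀ m n k → k ≤ m → count𝐧 (δ m n k) ≡ m
count𝐧-δ m n k k≤m = begin
  count𝐧 (replicate (n ∸ k) 𝐞 ++ ne^ k ++ R)           ≡⟨ count-++ 𝐧 (replicate (n ∸ k) 𝐞) _ ⟩
  count𝐧 (replicate (n ∸ k) 𝐞) + count𝐧 (ne^ k ++ R) ≡⟨ cong₂ _+_ (count𝐧-replicate-𝐞 (n ∸ k)) (count-++ 𝐧 (ne^ k) R) ⟩
  count𝐧 (ne^ k) + count𝐧 R                           ≡⟨ cong₂ _+_ (count-ne^ 𝐧 k) (count-replicate 𝐧 (m ∸ k)) ⟩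
  k + (m ∸ k)                                         ≡⟨ m+[n∸m]≡n k≤m ⟩
  m                                                   ∎
  where
  open ≡-Reasoning
  R = replicate (m ∸ k) 𝐧

count𝐞-δ : ∀ m n k → k ≤ n → count𝐞 (δ m n k) ≡ n
count𝐞-δ m n k k≤n = begin
  count𝐞 (replicate (n ∸ k) 𝐞 ++ ne^ k ++ R)           ≡⟨ count-++ 𝐞 (replicate (n ∸ k) 𝐞) _ ⟩
  count𝐞 (replicate (n ∸ k) 𝐞) + count𝐞 (ne^ k ++ R) ≡⟨ cong₂ _+_ (count-replicate 𝐞 (n ∸ k)) (count-++ 𝐞 (ne^ k) R) ⟩
  (n ∸ k) + (count𝐞 (ne^ k) + count𝐞 R)               ≡⟨ cong (λ x → (n ∸ k) + x) (cong₂ _+_ (count-ne^ 𝐞 k) (count𝐞-replicate-𝐧 (m ∸ k))) ⟩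
  (n ∸ k) + (k + 0)                                   ≡⟨ cong ((n ∸ k) +_) (+-identityʳ k) ⟩
  (n ∸ k) + k                                         ≡⟨ m∸n+n≡m k≤n ⟩
  n                                                   ∎
  where
  open ≡-Reasoning
  R = replicate (m ∸ k) 𝐧

samePoint-δ : ∀ {m n k w} → count𝐧 w ≡ m → count𝐞 w ≡ n → k ≤ m → k ≤ n → SamePoint w (δ m n k)
samePoint-δ {m} {n} {k} count𝐧w count𝐞w k≤m k≤n 𝐧 = trans count𝐧w (sym (count𝐧-δ m n k k≤m))
samePoint-δ {m} {n} {k} count𝐧w count𝐞w k≤m k≤n 𝐞 = trans count𝐞w (sym (count𝐞-δ m n k k≤n))

eastHeight-δ : ∀ m n k i → k ≤ n → i < n → eastHeight (δ m n k) i ≡ suc (i + k) ∸ n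
eastHeight-δ m n k i k≤n i<n with i <? (n ∸ k)
... | yes i<a = trans (eastHeight-replicate-𝐞 (n ∸ k) _ i i<a) (sym (m≤n⇒m∸n≡0 i+k<n))
  where
  i+k<n : suc (i + k) ≤ n
  i+k<n = subst (suc (i + k) ≤_) (m∸n+n≡m k≤n) (+-monoˡ-≤ k i<a)
... | no i≮a = begin
  eastHeight (δ m n k) i                        ≡⟨ cong (eastHeight (δ m n k)) a+j≡i ⟨
  eastHeight (δ m n k) (a + j)                  ≡⟨ eastHeight-replicate-𝐞-+ a _ j ⟩
  eastHeight (ne^ k ++ replicate (m ∸ k) 𝐧) j ≡⟨ eastHeight-ne^ k _ j j<k ⟩
  suc j                                         ≡⟨ m+n∸n≡m (suc j) n ⟨
  suc j + n ∸ n                                 ≡⟨ cong (λ x → suc j + x ∸ n) a+k≡n ⟨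
  suc j + (a + k) ∸ n                           ≡⟨ cong (_∸ n) (shuffle j a k) ⟩
  suc (a + j + k) ∸ n                           ≡⟨ cong (λ x → suc (x + k) ∸ n) a+j≡i ⟩
  suc (i + k) ∸ n                               ∎
  where
  open ≡-Reasoning
  a = n ∸ k
  j = i ∸ a
  a+k≡n : a + k ≡ n
  a+k≡n = m∸n+n≡m k≤n
  a+j≡i : a + j ≡ i
  a+j≡i = m+[n∸m]≡n (≮⇒≥ i≮a)
  j<k : j < k
  j<k = +-cancelˡ-< a j k (subst₂ _<_ (sym a+j≡i) (sym a+k≡n) i<n)
  shuffle : ∀ j a k → suc j + (a + k) ≡ suc (a + j + k)
  shuffle = solve-∀

en^ : ℕ → Word
en^ zero    = []
en^ (suc t) = 𝐞 ∷ 𝐧 ∷ en^ t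

count-en^ : ∀ l t → count l (en^ t) ≡ t
count-en^ 𝐧 zero    = refl
count-en^ 𝐧 (suc t) = cong suc (count-en^ 𝐧 t)
count-en^ 𝐞 zero    = refl
count-en^ 𝐞 (suc t) = cong suc (count-en^ 𝐞 t)

𝐞∷ne^-+ : ∀ t j → 𝐞 ∷ ne^ (t + j) ≡ en^ t ++ 𝐞 ∷ ne^ j
𝐞∷ne^-+ zero    j = refl
𝐞∷ne^-+ (suc t) j = cong (λ u → 𝐞 ∷ 𝐧 ∷ u) (𝐞∷ne^-+ t j)

-- δ_k split at its east step in column a + t, which has height t.
δ-split : ∀ m n k a t → a + suc k ≡ n → t ≤ k →
          δ m n k ≡ (replicate a 𝐞 ++ en^ t) ++ 𝐞 ∷ (ne^ (k ∸ t) ++ replicate (m ∸ k) 𝐧)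
δ-split m n k a t a+1+k≡n t≤k = begin
  replicate (n ∸ k) 𝐞 ++ ne^ k ++ R                 ≡⟨ cong (λ r → replicate r 𝐞 ++ ne^ k ++ R) n∸k≡1+a ⟩
  replicate (suc a) 𝐞 ++ ne^ k ++ R                 ≡⟨ replicate-suc-++ a ⟩
  replicate a 𝐞 ++ (𝐞 ∷ ne^ k) ++ R                 ≡⟨ cong (λ j → replicate a 𝐞 ++ (𝐞 ∷ ne^ j) ++ R) (m+[n∸m]≡n t≤k) ⟨
  replicate a 𝐞 ++ (𝐞 ∷ ne^ (t + (k ∸ t))) ++ R     ≡⟨ cong (λ u → replicate a 𝐞 ++ u ++ R) (𝐞∷ne^-+ t (k ∸ t)) ⟩
  replicate a 𝐞 ++ (en^ t ++ 𝐞 ∷ ne^ (k ∸ t)) ++ R ≡⟨ cong (replicate a 𝐞 ++_) (++-assoc (en^ t) _ R) ⟩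
  replicate a 𝐞 ++ en^ t ++ 𝐞 ∷ ne^ (k ∸ t) ++ R   ≡⟨ ++-assoc (replicate a 𝐞) (en^ t) _ ⟨
  (replicate a 𝐞 ++ en^ t) ++ 𝐞 ∷ ne^ (k ∸ t) ++ R ∎
  where
  open ≡-Reasoning
  R = replicate (m ∸ k) 𝐧
  n∸k≡1+a : n ∸ k ≡ suc a
  n∸k≡1+a = trans (cong (_∸ k) (trans (sym a+1+k≡n) (+-suc a k))) (m+n∸n≡m (suc a) k)
  replicate-suc-++ : ∀ a → replicate (suc a) 𝐞 ++ ne^ k ++ R ≡ replicate a 𝐞 ++ (𝐞 ∷ ne^ k) ++ R
  replicate-suc-++ zero    = refl
  replicate-suc-++ (suc a) = cong (𝐞 ∷_) (replicate-suc-++ a)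

ColumnsBelow : ℕ → Word → Word → Set
ColumnsBelow n u w = ∀ i → i < n → eastHeight u i ≤ eastHeight w i

weaklyBelow⇔columnsBelow : ∀ {m n u w} → count𝐧 u ≤ m → WeaklyBelow m n u w ⇔ ColumnsBelow n u w
weaklyBelow⇔columnsBelow {m} {n} {u} {w} u≤m = mk⇔ to from
  where
  to : WeaklyBelow m n u w → ColumnsBelow n u w
  to below i i<n with eastHeight w i <? m
  ... | yes h<m = below i (eastHeight w i) i<n h<m ≤-refl
  ... | no  h≮m = ≤-trans (eastHeight≤count𝐧 u i) (≤-trans u≤m (≮⇒≥ h≮m))
  from : ColumnsBelow n u w → WeaklyBelow m n u w
  from below i j i<n _ h≤j = ≤-trans (below i i<n) h≤j

-- δ_k has height (i + k + 1) ∸ n in column i; this states w ≥ δ_k without truncated subtraction.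
AboveStaircase : ℕ → ℕ → Word → Set
AboveStaircase n k w = ∀ i → i < n → suc (i + k) ≤ n + eastHeight w i

CrossesStaircase : ℕ → ℕ → Word → Set
CrossesStaircase n k w = ∃[ i ] (i < n × n + eastHeight w i < suc (i + k))

columnsBelow-δ⇔aboveStaircase : ∀ {m n k w} → k ≤ n → ColumnsBelow n (δ m n k) w ⇔ AboveStaircase n k w
columnsBelow-δ⇔aboveStaircase {m} {n} {k} {w} k≤n = mk⇔ to from
  where
  to : ColumnsBelow n (δ m n k) w → AboveStaircase n k w
  to below i i<n = ≤-trans (m≤n+m∸n (suc (i + k)) n)
    (+-monoʳ-≤ n (subst (_≤ eastHeight w i) (eastHeight-δ m n k i k≤n i<n) (below i i<n)))
  from : AboveStaircase n k w → ColumnsBelow n (δ m n k) w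
  from above i i<n = subst (_≤ eastHeight w i) (sym (eastHeight-δ m n k i k≤n i<n))
    (m≤n+o⇒m∸n≤o _ n (above i i<n))

weaklyBelow-δ⇔aboveStaircase : ∀ {m n k w} → k ≤ m ⊓ n → WeaklyBelow m n (δ m n k) w ⇔ AboveStaircase n k w
weaklyBelow-δ⇔aboveStaircase {m} {n} {k} {w} k≤m⊓n =
  ⇔-trans (weaklyBelow⇔columnsBelow {u = δ m n k} {w = w} (≤-reflexive (count𝐧-δ m n k (≤-trans k≤m⊓n (m⊓n≤m m n)))))
          (columnsBelow-δ⇔aboveStaircase {m = m} {w = w} (≤-trans k≤m⊓n (m⊓n≤n m n)))

aboveStaircase-zero : ∀ n w → AboveStaircase n 0 w
aboveStaircase-zero n w i i<n = ≤-trans (subst (_≤ n) (cong suc (sym (+-identityʳ i))) i<n) (m≤m+n n _)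

aboveStaircase-antitone : ∀ {n k k′ w} → k ≤ k′ → AboveStaircase n k′ w → AboveStaircase n k w
aboveStaircase-antitone {k = k} k≤k′ above i i<n = ≤-trans (s≤s (+-monoʳ-≤ i k≤k′)) (above i i<n)

all<-or-counterexample : ∀ {P : ℕ → Set} → Decidable P → ∀ n →
                         (∀ i → i < n → P i) ⊎ ∃[ i ] (i < n × ¬ P i)
all<-or-counterexample P? n with anyUpTo? (λ i → ¬? (P? i)) n
... | yes counterexample = inj₂ counterexample
... | no  ¬counterexample =
  inj₁ λ i i<n → decidable-stable (P? i) (λ ¬Pi → ¬counterexample (i , i<n , ¬Pi))

maximal-staircase : ∀ n w K →
  ∃[ k ] (k ≤ K × AboveStaircase n k w × (k ≡ K ⊎ CrossesStaircase n (suc k) w))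
maximal-staircase n w zero = 0 , z≤n , aboveStaircase-zero n w , inj₁ refl
maximal-staircase n w (suc K)
  with all<-or-counterexample (λ i → suc (i + suc K) ≤? n + eastHeight w i) n
... | inj₁ above = suc K , ≤-refl , above , inj₁ refl
... | inj₂ (i , i<n , ¬above) with maximal-staircase n w K
...   | k , k≤K , above , inj₁ refl    = k , m≤n⇒m≤1+n k≤K , above , inj₂ (i , i<n , ≰⇒> ¬above)
...   | k , k≤K , above , inj₂ crosses = k , m≤n⇒m≤1+n k≤K , above , inj₂ crosses

isMw : ∀ {m n k} w → k ≤ m ⊓ n → AboveStaircase n k w →
       (k ≡ m ⊓ n ⊎ CrossesStaircase n (suc k) w) → IsMw m n w k
isMw {m} {n} {k} w k≤m⊓n above top =
  k≤m⊓n , Equivalence.from (weaklyBelow-δ⇔aboveStaircase {w = w} k≤m⊓n) above , maximal top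
  where
  maximal : k ≡ m ⊓ n ⊎ CrossesStaircase n (suc k) w →
            ∀ k′ → k′ ≤ m ⊓ n → WeaklyBelow m n (δ m n k′) w → k′ ≤ k
  maximal top k′ k′≤m⊓n below with k′ ≤? k | top
  ... | yes k′≤k | _                         = k′≤k
  ... | no  _    | inj₁ refl                 = k′≤m⊓n
  ... | no  k′≰k | inj₂ (i , i<n , crosses) = ⊥-elim (<⇒≱ crosses
        (aboveStaircase-antitone {w = w} (≰⇒> k′≰k) (Equivalence.to (weaklyBelow-δ⇔aboveStaircase {w = w} k′≤m⊓n) below) i i<n))

-- w's east step in column (n ∸ (k+1)) + t lies on the step of δ_k at height t.
TouchesStaircase : ℕ → ℕ → Word → Set
TouchesStaircase n k w = ∃[ t ] (t ≤ k × eastHeight w (n ∸ suc k + t) ≡ t)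

touches-at-crossing : ∀ {n k} w → k < n → AboveStaircase n k w → CrossesStaircase n (suc k) w →
                      TouchesStaircase n k w
touches-at-crossing {n} {k} w k<n above (i , i<n , crosses) = h , h≤k , cong (eastHeight w) a+h≡i
  where
  a = n ∸ suc k
  h = eastHeight w i
  a+1+k≡n : a + suc k ≡ n
  a+1+k≡n = m∸n+n≡m k<n
  n+h≡1+i+k : n + h ≡ suc (i + k)
  n+h≡1+i+k = ≤-antisym (subst (n + h ≤_) (+-suc i k) (s≤s⁻¹ crosses)) (above i i<n)
  right-comm : ∀ x y z → x + y + z ≡ x + z + y
  right-comm = solve-∀
  a+h≡i : a + h ≡ i
  a+h≡i = +-cancelʳ-≡ (suc k) _ _ (begin
    a + h + suc k   ≡⟨ right-comm a h (suc k) ⟩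
    a + suc k + h   ≡⟨ cong (_+ h) a+1+k≡n ⟩
    n + h           ≡⟨ n+h≡1+i+k ⟩
    suc (i + k)     ≡⟨ +-suc i k ⟨
    i + suc k       ∎)
    where open ≡-Reasoning
  h≤k : h ≤ k
  h≤k = s≤s⁻¹ (+-cancelˡ-< a h (suc k) (subst₂ _<_ (sym a+h≡i) (sym a+1+k≡n) i<n))

touches-at-top : ∀ {n k} w → k < n → count𝐧 w ≡ k → AboveStaircase n k w → TouchesStaircase n k w
touches-at-top {n} {k} w k<n count𝐧w≡k above = k , ≤-refl , ≤-antisym upper lower
  where
  a = n ∸ suc k
  a+1+k≡n : a + suc k ≡ n
  a+1+k≡n = m∸n+n≡m k<n
  upper : eastHeight w (a + k) ≤ k
  upper = subst (eastHeight w (a + k) ≤_) count𝐧w≡k (eastHeight≤count𝐧 w (a + k))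
  lower : k ≤ eastHeight w (a + k)
  lower = +-cancelˡ-≤ (a + suc k) _ _ (subst₂ _≤_ (shuffle a k) (cong (_+ eastHeight w (a + k)) (sym a+1+k≡n))
            (above (a + k) (subst (a + k <_) a+1+k≡n (+-monoʳ-< a ≤-refl))))
    where
    shuffle : ∀ a k → suc (a + k + k) ≡ a + suc k + k
    shuffle = solve-∀

endsWith𝐧-∷ʳ : ∀ A A′ l → EndsWith𝐧 (A ∷ʳ l) → EndsWith𝐧 (A′ ∷ʳ l)
endsWith𝐧-∷ʳ A A′ l (q , eq) = A′ , cong (A′ ∷ʳ_) (proj₂ (∷ʳ-injective A q eq))

CriticalFor : Word → Word → Set
CriticalFor w d = ∃[ p ] ∃[ f ] ∃[ s ] (w ≡ p ++ f ++ s × Admissible p f s × SharedEdge p f d)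

module Divergence {w d : Word} (sameEnd : SamePoint w d) (under : ColumnsBelow (count𝐞 w) d w)
                  (d-shape : No𝐞After𝐧𝐧 d) where

  suffix-samePoint : ∀ {A A′ B B′} → w ≡ A ++ B → d ≡ A′ ++ B′ → SamePoint A A′ → SamePoint B B′
  suffix-samePoint {B = B} {B′} eqw eqd same =
    samePoint-cancelˡ B B′ same (subst₂ SamePoint eqw eqd sameEnd)

  tail-samePoint : ∀ {A A′ l B B′} → w ≡ A ++ l ∷ B → d ≡ A′ ++ l ∷ B′ → SamePoint A A′ → SamePoint B B′
  tail-samePoint {l = l} {B} {B′} eqw eqd same =
    samePoint-cancelˡ {l ∷ []} B B′ (λ _ → refl) (suffix-samePoint eqw eqd same)

  ¬diverge-𝐞𝐧 : ∀ {X Y X′ Y′} → w ≡ X ++ 𝐞 ∷ Y → d ≡ X′ ++ 𝐧 ∷ Y′ → SamePoint X X′ → ⊥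
  ¬diverge-𝐞𝐧 {X} {Y} {X′} {Y′} eqw eqd same = <⇒≱ w<d (under (count𝐞 X) column<)
    where
    column< : count𝐞 X < count𝐞 w
    column< = subst (count𝐞 X <_) (trans (sym (count-++ 𝐞 X (𝐞 ∷ Y))) (cong count𝐞 (sym eqw))) (m<m+n _ z<s)
    w<d : eastHeight w (count𝐞 X) < eastHeight d (count𝐞 X)
    w<d = begin-strict
      eastHeight w (count𝐞 X)                 ≡⟨ cong (λ u → eastHeight u (count𝐞 X)) eqw ⟩
      eastHeight (X ++ 𝐞 ∷ Y) (count𝐞 X)      ≡⟨ eastHeight-at-𝐞 X Y ⟩
      count𝐧 X                                ≡⟨ same 𝐧 ⟩
      count𝐧 X′                               <⟨ eastHeight-at-𝐧 X′ Y′ ⟩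
      eastHeight (X′ ++ 𝐧 ∷ Y′) (count𝐞 X′) ≡⟨ cong₂ eastHeight (sym eqd) (sym (same 𝐞)) ⟩
      eastHeight d (count𝐞 X)                 ∎
      where open ≤-Reasoning

  ¬merge-𝐧𝐞 : ∀ {X T X′ T′} → w ≡ X ++ 𝐧 ∷ T → d ≡ X′ ++ 𝐞 ∷ T′ → SamePoint (X ∷ʳ 𝐧) (X′ ∷ʳ 𝐞) → ⊥
  ¬merge-𝐧𝐞 {X} {T} {X′} {T′} eqw eqd same = <⇒≱ w<d (under column (<-≤-trans column<X X≤w))
    where
    column = count𝐞 X′
    shifted : ∀ l → count l X + count l (𝐧 ∷ []) ≡ count l X′ + count l (𝐞 ∷ [])
    shifted l = trans (sym (count-++ l X _)) (trans (same l) (count-++ l X′ _))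
    column<X : column < count𝐞 X
    column<X = ≤-reflexive (sym (trans (sym (+-identityʳ _)) (trans (shifted 𝐞) (+-comm column 1))))
    X≤w : count𝐞 X ≤ count𝐞 w
    X≤w = subst (count𝐞 X ≤_) (cong count𝐞 (sym eqw)) (count-prefix-≤ 𝐞 X _)
    w<d : eastHeight w column < eastHeight d column
    w<d = begin-strict
      eastHeight w column             ≡⟨ cong (λ u → eastHeight u column) eqw ⟩
      eastHeight (X ++ 𝐧 ∷ T) column  ≤⟨ eastHeight-++-< X _ column column<X ⟩
      count𝐧 X                        <⟨ m<m+n _ z<s ⟩
      count𝐧 X + 1                    ≡⟨ shifted 𝐧 ⟩
      count𝐧 X′ + 0                   ≡⟨ +-identityʳ _ ⟩
      count𝐧 X′                       ≡⟨ eastHeight-at-𝐞 X′ T′ ⟨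
      eastHeight (X′ ++ 𝐞 ∷ T′) column ≡⟨ cong (λ u → eastHeight u column) eqd ⟨
      eastHeight d column             ∎
      where open ≤-Reasoning

  no𝐞-after-𝐧𝐧 : ∀ {A′ B′} → EndsWith𝐧 A′ → d ≡ A′ ++ 𝐧 ∷ B′ → count𝐞 B′ ≡ 0
  no𝐞-after-𝐧𝐧 {B′ = B′} (q , refl) eqd =
    No𝐞After𝐧𝐧-𝐧𝐧 q B′ (subst No𝐞After𝐧𝐧 (trans eqd (∷ʳ-++ q 𝐧 (𝐧 ∷ B′))) d-shape)

  forward-critical : ∀ {A A′ B B′} → w ≡ A ++ 𝐧 ∷ 𝐧 ∷ B → d ≡ A′ ++ 𝐧 ∷ 𝐞 ∷ B′ → SamePoint A A′ →
                     ¬ EndsWith𝐧 A → CriticalFor w d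
  forward-critical {A} {A′} {B} {B′} eqw eqd same ¬A𝐧 with split-leading-𝐧 B
  ... | inj₂ count𝐞B≡0 = ⊥-elim (0≢1+n (trans (sym count𝐞B≡0) (suffix-samePoint eqw eqd same 𝐞)))
  ... | inj₁ (j , v , refl) =
    A , replicate (suc (suc j)) 𝐧 ++ 𝐞 ∷ [] , v ,
    trans eqw (cong (λ u → A ++ 𝐧 ∷ 𝐧 ∷ u) (sym (++-assoc (replicate j 𝐧) (𝐞 ∷ []) v))) ,
    inj₁ (suc (suc j) , s≤s (s≤s z≤n) , refl , ¬A𝐧) ,
    sharedEdge [] 𝐧 _ A′ (𝐞 ∷ B′) refl eqd (subst (λ u → SamePoint u A′) (sym (++-identityʳ A)) same)

  -- The last hypothesis: if l = 𝐧 continues a run of 𝐧 in w, it continues one in d as well.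
  forward : ∀ A A′ l B B′ → w ≡ A ++ l ∷ B → d ≡ A′ ++ l ∷ B′ → SamePoint A A′ → No𝐞𝐞 (l ∷ B′) →
            l ≡ 𝐞 ⊎ (EndsWith𝐧 A → EndsWith𝐧 A′) → B ≡ B′ ⊎ CriticalFor w d
  forward A A′ l [] B′ eqw eqd same _ _ =
    inj₁ (sym (samePoint-[] (samePoint-sym (tail-samePoint eqw eqd same))))
  forward A A′ l (x ∷ B) [] eqw eqd same _ _ with samePoint-[] (tail-samePoint eqw eqd same)
  ... | ()
  forward A A′ l (𝐧 ∷ B) (𝐧 ∷ B′) eqw eqd same noEE _ =
    Sum.map₁ (cong (𝐧 ∷_)) (forward (A ∷ʳ l) (A′ ∷ʳ l) 𝐧 B B′
      (trans eqw (sym (∷ʳ-++ A l _))) (trans eqd (sym (∷ʳ-++ A′ l _))) (samePoint-++ʳ (l ∷ []) same)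
      (No𝐞𝐞-tail l _ noEE) (inj₂ (endsWith𝐧-∷ʳ A A′ l)))
  forward A A′ l (𝐞 ∷ B) (𝐞 ∷ B′) eqw eqd same noEE _ =
    Sum.map₁ (cong (𝐞 ∷_)) (forward (A ∷ʳ l) (A′ ∷ʳ l) 𝐞 B B′
      (trans eqw (sym (∷ʳ-++ A l _))) (trans eqd (sym (∷ʳ-++ A′ l _))) (samePoint-++ʳ (l ∷ []) same)
      (No𝐞𝐞-tail l _ noEE) (inj₁ refl))
  forward A A′ l (𝐞 ∷ B) (𝐧 ∷ B′) eqw eqd same _ _ =
    ⊥-elim (¬diverge-𝐞𝐧 (trans eqw (sym (∷ʳ-++ A l _))) (trans eqd (sym (∷ʳ-++ A′ l _)))
                        (samePoint-++ʳ (l ∷ []) same))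
  forward A A′ 𝐞 (𝐧 ∷ B) (𝐞 ∷ B′) _ _ _ () _
  forward A A′ 𝐧 (𝐧 ∷ B) (𝐞 ∷ B′) _ _ _ _ (inj₁ ())
  forward A A′ 𝐧 (𝐧 ∷ B) (𝐞 ∷ B′) eqw eqd same _ (inj₂ runs) with endsWith𝐧? A
  ... | yes A𝐧 = ⊥-elim (0≢1+n (sym (no𝐞-after-𝐧𝐧 (runs A𝐧) eqd)))
  ... | no ¬A𝐧 = inj₂ (forward-critical eqw eqd same ¬A𝐧)

  backward-critical : ∀ {X T X′} → w ≡ X ++ 𝐞 ∷ T → d ≡ X′ ++ 𝐧 ∷ T → SamePoint (X ∷ʳ 𝐞) (X′ ∷ʳ 𝐧) →
                      0 < count𝐞 T → CriticalFor w d
  backward-critical {T = 𝐧 ∷ T} eqw eqd same T𝐞 =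
    ⊥-elim (<⇒≢ T𝐞 (sym (no𝐞-after-𝐧𝐧 (_ , refl) (trans eqd (sym (∷ʳ-++ _ 𝐧 _))))))
  backward-critical {X} {𝐞 ∷ T} {X′} eqw eqd same _ with split-trailing-𝐞 X
  ... | inj₁ (j , refl) = ⊥-elim (0≢1+n (trans (sym (no𝐧 j)) (trans (same 𝐧) (count𝐧-∷ʳ-𝐧 X′))))
    where
    no𝐧 : ∀ j → count𝐧 (replicate j 𝐞 ∷ʳ 𝐞) ≡ 0
    no𝐧 zero    = refl
    no𝐧 (suc j) = no𝐧 j
  ... | inj₂ (u , j , refl) with split-leading-𝐞 T
  ...   | r , v , refl , ¬𝐞v =
    u , 𝐧 ∷ replicate (j + suc (suc r)) 𝐞 , v , eqw′ ,
    inj₂ (j + suc (suc r) , ≤-trans (m≤m+n 2 r) (m≤n+m _ j) , refl , ¬𝐞v) ,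
    sharedEdge (𝐧 ∷ replicate j 𝐞 ∷ʳ 𝐞) 𝐞 (replicate r 𝐞) (X′ ∷ʳ 𝐧) _ run-split
               (trans eqd (sym (∷ʳ-++ X′ 𝐧 _))) (subst (λ x → SamePoint x (X′ ∷ʳ 𝐧)) X-split same)
    where
    open ≡-Reasoning
    run-split : 𝐧 ∷ replicate (j + suc (suc r)) 𝐞 ≡ (𝐧 ∷ replicate j 𝐞 ∷ʳ 𝐞) ++ 𝐞 ∷ replicate r 𝐞
    run-split = cong (𝐧 ∷_) (trans (replicate-+ 𝐞 j (suc (suc r))) (sym (∷ʳ-++ (replicate j 𝐞) 𝐞 _)))
    X-split : (u ++ 𝐧 ∷ replicate j 𝐞) ∷ʳ 𝐞 ≡ u ++ 𝐧 ∷ replicate j 𝐞 ∷ʳ 𝐞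
    X-split = ++-assoc u (𝐧 ∷ replicate j 𝐞) (𝐞 ∷ [])
    eqw′ : w ≡ u ++ (𝐧 ∷ replicate (j + suc (suc r)) 𝐞) ++ v
    eqw′ = begin
      w                                                       ≡⟨ eqw ⟩
      (u ++ 𝐧 ∷ replicate j 𝐞) ++ 𝐞 ∷ 𝐞 ∷ replicate r 𝐞 ++ v ≡⟨ ++-assoc u _ _ ⟩
      u ++ 𝐧 ∷ replicate j 𝐞 ++ 𝐞 ∷ 𝐞 ∷ replicate r 𝐞 ++ v   ≡⟨ cong (λ x → u ++ 𝐧 ∷ x) (++-assoc (replicate j 𝐞) _ v) ⟨
      u ++ 𝐧 ∷ (replicate j 𝐞 ++ 𝐞 ∷ 𝐞 ∷ replicate r 𝐞) ++ v ≡⟨ cong (λ x → u ++ 𝐧 ∷ x ++ v) (replicate-+ 𝐞 j (suc (suc r))) ⟨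
      u ++ 𝐧 ∷ replicate (j + suc (suc r)) 𝐞 ++ v            ∎

  backward-view : ∀ {A A′} → Reverse A → Reverse A′ → ∀ T → w ≡ A ++ T → d ≡ A′ ++ T → SamePoint A A′ →
                  0 < count𝐞 T → A ≡ A′ ⊎ CriticalFor w d
  backward-view [] _ T _ _ same _ = inj₁ (sym (samePoint-[] (samePoint-sym same)))
  backward-view (X ∶ _ ∶ʳ x) [] T _ _ same _ = ⊥-elim (∷ʳ≢[] X (samePoint-[] same))
    where
    ∷ʳ≢[] : ∀ X → X ∷ʳ x ≢ []
    ∷ʳ≢[] []      ()
    ∷ʳ≢[] (_ ∷ _) ()
  backward-view (X ∶ rX ∶ʳ 𝐧) (X′ ∶ rX′ ∶ʳ 𝐧) T eqw eqd same T𝐞 =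
    Sum.map₁ (cong (_∷ʳ 𝐧)) (backward-view rX rX′ (𝐧 ∷ T)
      (trans eqw (∷ʳ-++ X 𝐧 T)) (trans eqd (∷ʳ-++ X′ 𝐧 T)) (samePoint-cancelʳ (𝐧 ∷ []) same) T𝐞)
  backward-view (X ∶ rX ∶ʳ 𝐞) (X′ ∶ rX′ ∶ʳ 𝐞) T eqw eqd same _ =
    Sum.map₁ (cong (_∷ʳ 𝐞)) (backward-view rX rX′ (𝐞 ∷ T)
      (trans eqw (∷ʳ-++ X 𝐞 T)) (trans eqd (∷ʳ-++ X′ 𝐞 T)) (samePoint-cancelʳ (𝐞 ∷ []) same) z<s)
  backward-view (X ∶ _ ∶ʳ 𝐧) (X′ ∶ _ ∶ʳ 𝐞) T eqw eqd same _ =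
    ⊥-elim (¬merge-𝐧𝐞 (trans eqw (∷ʳ-++ X 𝐧 T)) (trans eqd (∷ʳ-++ X′ 𝐞 T)) same)
  backward-view (X ∶ _ ∶ʳ 𝐞) (X′ ∶ _ ∶ʳ 𝐧) T eqw eqd same T𝐞 =
    inj₂ (backward-critical (trans eqw (∷ʳ-++ X 𝐞 T)) (trans eqd (∷ʳ-++ X′ 𝐧 T)) same T𝐞)

  agree-or-critical : ∀ A A′ l B B′ → w ≡ A ++ l ∷ B → d ≡ A′ ++ l ∷ B′ → SamePoint A A′ → No𝐞𝐞 (l ∷ B′) →
                      l ≡ 𝐞 ⊎ (EndsWith𝐧 A → EndsWith𝐧 A′) → 0 < count𝐞 (l ∷ B) → w ≡ d ⊎ CriticalFor w d
  agree-or-critical A A′ l B B′ eqw eqd same noEE runs B𝐞 with forward A A′ l B B′ eqw eqd same noEE runs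
  ... | inj₂ critical = inj₂ critical
  ... | inj₁ refl with backward-view (reverseView A) (reverseView A′) (l ∷ B) eqw eqd same B𝐞
  ...   | inj₂ critical = inj₂ critical
  ...   | inj₁ refl     = inj₁ (trans eqw (sym eqd))

module StaircaseDivergence {m n k} w (count𝐧w : count𝐧 w ≡ m) (count𝐞w : count𝐞 w ≡ n) (k≤m : k ≤ m) (k≤n : k ≤ n)
                           (above : AboveStaircase n k w) =
  Divergence {w} (samePoint-δ {w = w} count𝐧w count𝐞w k≤m k≤n)
             (subst (λ c → ColumnsBelow c (δ m n k) w) (sym count𝐞w)
                    (Equivalence.from (columnsBelow-δ⇔aboveStaircase {w = w} k≤n) above))
             (δ-No𝐞After𝐧𝐧 m n k)

agree-or-critical-< : ∀ {m n k} w → count𝐧 w ≡ m → count𝐞 w ≡ n → k ≤ m → k < n → AboveStaircase n k w →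
                      TouchesStaircase n k w → w ≡ δ m n k ⊎ CriticalFor w (δ m n k)
agree-or-critical-< {m} {n} {k} w count𝐧w count𝐞w k≤m k<n above (t , t≤k , height)
  with splitAt-𝐞 w (a + t) (subst (a + t <_) (sym count𝐞w) column<n)
  where
  a = n ∸ suc k
  column<n : a + t < n
  column<n = subst (a + t <_) (m∸n+n≡m k<n) (+-monoʳ-< a (s≤s t≤k))
... | A , B , eqw , count𝐞A , count𝐧A =
  agree-or-critical A A′ 𝐞 B (ne^ (k ∸ t) ++ replicate (m ∸ k) 𝐧) eqw
    (δ-split m n k a t (m∸n+n≡m k<n) t≤k) same (No𝐞𝐞-𝐞∷ne^++replicate-𝐧 (k ∸ t) (m ∸ k)) (inj₁ refl) z<s
  where
  open StaircaseDivergence w count𝐧w count𝐞w k≤m (<⇒≤ k<n) above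
  a = n ∸ suc k
  A′ = replicate a 𝐞 ++ en^ t
  same : SamePoint A A′
  same 𝐞 = trans count𝐞A (sym (trans (count-++ 𝐞 (replicate a 𝐞) _) (cong₂ _+_ (count-replicate 𝐞 a) (count-en^ 𝐞 t))))
  same 𝐧 = trans count𝐧A (trans height
             (sym (trans (count-++ 𝐧 (replicate a 𝐞) _) (cong₂ _+_ (count𝐧-replicate-𝐞 a) (count-en^ 𝐧 t)))))

agree-or-critical-≡ : ∀ {m n} w → count𝐧 w ≡ m → count𝐞 w ≡ n → n ≤ m → AboveStaircase n n w →
                      w ≡ δ m n n ⊎ CriticalFor w (δ m n n)
agree-or-critical-≡ {m} {zero} w count𝐧w count𝐞w _ _ =
  inj₁ (trans (count𝐞≡0⇒replicate-𝐧 w count𝐞w) (cong (λ r → replicate r 𝐧) count𝐧w))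
agree-or-critical-≡ {m} {suc n} w count𝐧w count𝐞w n≤m above = first-step w refl
  where
  open StaircaseDivergence w count𝐧w count𝐞w n≤m ≤-refl above
  eqd : δ m (suc n) (suc n) ≡ [] ++ 𝐧 ∷ 𝐞 ∷ ne^ n ++ replicate (m ∸ suc n) 𝐧
  eqd = cong (λ r → replicate r 𝐞 ++ ne^ (suc n) ++ replicate (m ∸ suc n) 𝐧) (n∸n≡0 n)
  first-step : ∀ v → w ≡ v → w ≡ δ m (suc n) (suc n) ⊎ CriticalFor w (δ m (suc n) (suc n))
  first-step []      eq = ⊥-elim (0≢1+n (trans (cong count𝐞 (sym eq)) count𝐞w))
  first-step (𝐞 ∷ v) eq = ⊥-elim (¬diverge-𝐞𝐧 {X = []} eq eqd (λ _ → refl))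
  first-step (𝐧 ∷ v) eq = agree-or-critical [] [] 𝐧 v _ eq eqd (λ _ → refl)
    (No𝐞𝐞-𝐞∷ne^++replicate-𝐧 n (m ∸ suc n)) (inj₂ (λ ends → ends))
    (subst (0 <_) (trans (sym count𝐞w) (cong count𝐞 eq)) z<s)

staircase-or-critical : ∀ m n w → count𝐧 w ≡ m → count𝐞 w ≡ n →
                        (∃[ k ] (k ≤ m ⊓ n × w ≡ δ m n k)) ⊎ HasCriticalFactor m n w
staircase-or-critical m n w count𝐧w count𝐞w with maximal-staircase n w (m ⊓ n)
... | k , k≤m⊓n , above , top = Sum.map (λ w≡δ → k , k≤m⊓n , w≡δ) critical agreement
  where
  k≤m : k ≤ m
  k≤m = ≤-trans k≤m⊓n (m⊓n≤m m n)
  touches : k ≡ m ⊓ n ⊎ CrossesStaircase n (suc k) w → k < n → TouchesStaircase n k w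
  touches (inj₂ crosses) k<n = touches-at-crossing w k<n above crosses
  touches (inj₁ k≡m⊓n)  k<n with ⊓-sel m n
  ... | inj₁ m⊓n≡m = touches-at-top w k<n (trans count𝐧w (sym (trans k≡m⊓n m⊓n≡m))) above
  ... | inj₂ m⊓n≡n = ⊥-elim (<-irrefl (trans k≡m⊓n m⊓n≡n) k<n)
  agreement : w ≡ δ m n k ⊎ CriticalFor w (δ m n k)
  agreement with m≤n⇒m<n∨m≡n (≤-trans k≤m⊓n (m⊓n≤n m n))
  ... | inj₁ k<n  = agree-or-critical-< w count𝐧w count𝐞w k≤m k<n above (touches top k<n)
  ... | inj₂ refl = agree-or-critical-≡ w count𝐧w count𝐞w k≤m above
  critical : CriticalFor w (δ m n k) → HasCriticalFactor m n w
  critical (p , f , s , eq , admissible , shared) = p , f , s , eq , admissible , k , isMw w k≤m⊓n above top , shared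

lemma3p7 : (m n : ℕ) (w : Word) → count𝐧 w ≡ m → count𝐞 w ≡ n →
    (¬ HasCriticalFactor m n w) ⇔ (∃[ k ] (k ≤ m ⊓ n × w ≡ δ m n k))
lemma3p7 m n w count𝐧w count𝐞w = mk⇔ staircase noCritical
  where
  staircase : ¬ HasCriticalFactor m n w → ∃[ k ] (k ≤ m ⊓ n × w ≡ δ m n k)
  staircase ¬critical with staircase-or-critical m n w count𝐧w count𝐞w
  ... | inj₁ isStaircase = isStaircase
  ... | inj₂ critical    = ⊥-elim (¬critical critical)
  noCritical : ∃[ k ] (k ≤ m ⊓ n × w ≡ δ m n k) → ¬ HasCriticalFactor m n w
  noCritical (k , _ , refl) (p , f , s , eq , admissible , _) = δ-¬Admissible m n k p f s eq admissible
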